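{- For all integers $n \geq 1$, \[ q_1^{(3)}(n) - Q_1^{(3,-)}(n) \geq 0. \]
   Context: $q_1^{(3)}(n)$ denotes the number of partitions of $n$ into distinct parts each at least $3$. $Q_1^{(3,-)}(n)$ denotes the number of partitions of $n$ into parts congruent to $3$ or $-3$ modulo $4$, where the part $1$ is not allowed (equivalently, partitions of $n$ into odd parts each at least $3$). -}

module Defs where

open import Data.Nat using (ℕ; zero; suc; _+_; _≤_; _<_; _≤?_; _<?_; _≟_; _∸_)
open import Data.Nat.Properties using ()
open import Data.List using (List; []; _∷_; length; filter; sum; map; concatMap; upTo; applyUpTo)
open import Data.List.Relation.Unary.All using (All; all?)
open import Data.List.Relation.Unary.Linked using (Linked; linked?)
open import Data.Product using (_×_)
open import Relation.Nullary using (Dec; yes; no; ¬_)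
open import Relation.Nullary.Decidable using (_×-dec_)
open import Relation.Unary using (Decidable)
open import Data.Nat.Divisibility using (_∣_; _∣?_)

-- A partition is represented as a weakly decreasing list of positive parts.
-- partitionsBounded fuel m n : all weakly decreasing lists of parts in [1..m]
-- summing to n (fuel ≥ n guarantees completeness; every part uses ≥ 1 of n).
partitionsBounded : ℕ → ℕ → ℕ → List (List ℕ)
partitionsBounded _ _ zero = [] ∷ []
partitionsBounded zero _ (suc _) = []
partitionsBounded (suc fuel) m (suc n) =
  concatMap (λ k → go (suc k)) (upTo m)
  where
  go : ℕ → List (List ℕ)
  go p with p ≤? suc n
  ... | yes _ = map (p ∷_) (partitionsBounded fuel p (suc n ∸ p))
  ... | no _ = []

partitions : ℕ → List (List ℕ)
partitions n = partitionsBounded n n n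

DistinctParts : List ℕ → Set
DistinctParts = Linked (λ a b → b < a)

distinctParts? : (xs : List ℕ) → Dec (DistinctParts xs)
distinctParts? = linked? (λ a b → b <? a)

PartsAtLeast3 : List ℕ → Set
PartsAtLeast3 = All (3 ≤_)

Odd : ℕ → Set
Odd m = ¬ (2 ∣ m)

odd? : (m : ℕ) → Dec (Odd m)
odd? m with 2 ∣? m
... | yes p = no (λ f → f p)
... | no p = yes p

q1-3 : ℕ → ℕ
q1-3 n = length (filter (λ xs → distinctParts? xs ×-dec all? (3 ≤?_) xs) (partitions n))

-- Q₁⁽³,⁻⁾(n): partitions of n into parts ≡ ±3 (mod 4), part 1 excluded,
-- i.e. odd parts each ≥ 3
Q1-3m : ℕ → ℕ
Q1-3m n = length (filter (λ xs → all? odd? xs ×-dec all? (3 ≤?_) xs) (partitions n))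

-- Glaisher's map: merge two equal parts into one of twice the size until all parts are
-- distinct. An odd part j occurring m times becomes the parts j · 2^i for the binary digits i
-- of m, so the sum is kept, the parts stay ≥ 3, and the result has distinct parts. Since
-- j · 2^i determines (j , i) for odd j, the multiplicities of the original partition can be
-- read off the image, so the map is injective.

module Submission where

open import Defs
open import Data.Nat using (ℕ; zero; suc; pred; _+_; _*_; _^_; _∸_; _≤_; _≥_; _<_; s≤s; z≤n)
open import Data.Nat.Properties
open import Data.Nat.ListAction using (sum)
open import Data.Nat.ListAction.Properties using (sum-↭)
open import Data.Nat.Divisibility using (_∣_; m∣m*n; ∣n⇒∣m*n)
open import Algebra.Properties.CommutativeSemigroup +-commutativeSemigroup using (x∙yz≈y∙xz)
open import Algebra.Properties.CommutativeSemigroup *-commutativeSemigroup as * using ()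
open import Data.List using (List; []; _∷_; _++_; map; foldr; concatMap; upTo; length; filter; reverse; reverseAcc)
open import Data.List.Properties using (concatMap-cong; ∷-injective; reverse-injective; length-map; length-++-sucʳ)
open import Data.List.Membership.Propositional using (_∈_; find; lose)
open import Data.List.Membership.Propositional.Properties
open import Data.List.Relation.Unary.All as All using (All; []; _∷_; all?)
import Data.List.Relation.Unary.All.Properties as All
open import Data.List.Relation.Unary.Any using (here; there)
open import Data.List.Relation.Unary.AllPairs using ([]; _∷_)
open import Data.List.Relation.Unary.Linked as Linked using (Linked; []; [-]; _∷_)
open import Data.List.Relation.Unary.Linked.Properties using (Linked⇒AllPairs)
open import Data.List.Relation.Unary.Unique.Propositional using (Unique)
import Data.List.Relation.Unary.Unique.Propositional.Properties as Unique
open import Data.List.Relation.Binary.Permutation.Propositional using (↭-sym)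
open import Data.List.Relation.Binary.Permutation.Propositional.Properties using (↭-reverse; All-resp-↭)
open import Data.Product using (_×_; _,_; proj₁; proj₂; ∃-syntax)
open import Data.Empty using (⊥-elim)
open import Function using (_∘_; flip)
open import Relation.Nullary using (Dec; yes; no; ¬_)
open import Relation.Nullary.Decidable using (_×-dec_)
open import Relation.Unary using (Decidable)
open import Relation.Binary using (Transitive; tri<; tri≈; tri>)
open import Relation.Binary.PropositionalEquality using (_≡_; _≢_; refl; sym; trans; cong; cong₂; subst; module ≡-Reasoning)

Linked-reverse⁺ : ∀ {A : Set} {R : A → A → Set} {xs} → Linked R xs → Linked (flip R) (reverse xs)
Linked-reverse⁺ [] = []
Linked-reverse⁺ {R = R} {_ ∷ _} lk = onto lk [-]
  where
  onto : ∀ {x xs acc} → Linked R (x ∷ xs) → Linked (flip R) (x ∷ acc) →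
         Linked (flip R) (reverseAcc (x ∷ acc) xs)
  onto [-] racc = racc
  onto (r ∷ lk) racc = onto lk (r ∷ racc)

Linked-skip : ∀ {A : Set} {R : A → A → Set} → Transitive R →
  ∀ {x y ys} → Linked R (x ∷ y ∷ ys) → Linked R (x ∷ ys)
Linked-skip _ {ys = []} _ = [-]
Linked-skip trans {ys = _ ∷ _} (r ∷ r′ ∷ lk) = trans r r′ ∷ lk

Descending : List ℕ → Set
Descending = Linked _≥_

Descending⇒All≤head : ∀ {x xs} → Descending (x ∷ xs) → All (_≤ x) xs
Descending⇒All≤head [-] = []
Descending⇒All≤head (y≤x ∷ d) = y≤x ∷ All.map (λ z≤y → ≤-trans z≤y y≤x) (Descending⇒All≤head d)

All≤head⇒Descending : ∀ {x xs} → All (_≤ x) xs → Descending xs → Descending (x ∷ xs)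
All≤head⇒Descending [] [] = [-]
All≤head⇒Descending (y≤x ∷ _) d = y≤x ∷ d

∈⇒≤sum : ∀ xs → All (_≤ sum xs) xs
∈⇒≤sum [] = []
∈⇒≤sum (x ∷ xs) = m≤m+n x (sum xs) ∷ All.map (λ y≤ → ≤-trans y≤ (m≤n+m (sum xs) x)) (∈⇒≤sum xs)

∈-++-∷-≢ : ∀ {A : Set} (as : List A) {bs : List A} {c z : A} → z ∈ as ++ c ∷ bs → z ≢ c → z ∈ as ++ bs
∈-++-∷-≢ [] (here z≡c) z≢c = ⊥-elim (z≢c z≡c)
∈-++-∷-≢ [] (there z∈) _ = z∈
∈-++-∷-≢ (a ∷ as) (here z≡a) _ = here z≡a
∈-++-∷-≢ (a ∷ as) (there z∈) z≢c = there (∈-++-∷-≢ as z∈ z≢c)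

Unique-⊆⇒length≤ : ∀ {A : Set} {xs ys : List A} → Unique xs → (∀ {x} → x ∈ xs → x ∈ ys) →
  length xs ≤ length ys
Unique-⊆⇒length≤ {xs = []} _ _ = z≤n
Unique-⊆⇒length≤ {xs = x ∷ xs} (x∉xs ∷ xs-unique) xs⊆ys
  with as , bs , refl ← ∈-∃++ (xs⊆ys (here refl)) =
  ≤-trans (s≤s (Unique-⊆⇒length≤ xs-unique xs⊆as++bs)) (≤-reflexive (sym (length-++-sucʳ as x bs)))
  where
  xs⊆as++bs : ∀ {z} → z ∈ xs → z ∈ as ++ bs
  xs⊆as++bs z∈ = ∈-++-∷-≢ as (xs⊆ys (there z∈)) (λ z≡x → All.lookup x∉xs z∈ (sym z≡x))

map-unique : ∀ {A B : Set} (F : A → B) {xs} → Unique xs →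
  (∀ {x y} → x ∈ xs → y ∈ xs → F x ≡ F y → x ≡ y) → Unique (map F xs)
map-unique F {[]} _ _ = []
map-unique F {x ∷ xs} (x∉xs ∷ xs-unique) F-inj =
  All.map⁺ (All.tabulate (λ y∈ Fx≡Fy → All.lookup x∉xs y∈ (F-inj (here refl) (there y∈) Fx≡Fy)))
  ∷ map-unique F xs-unique (λ x∈ y∈ → F-inj (there x∈) (there y∈))

length-filter-≤-injection : ∀ {A : Set} {P Q : A → Set} (P? : Decidable P) (Q? : Decidable Q) {L : List A} →
  Unique L → (F : A → A) → (∀ {x} → x ∈ L → P x → F x ∈ L × Q (F x)) →
  (∀ {x y} → x ∈ L → y ∈ L → P x → P y → F x ≡ F y → x ≡ y) →
  length (filter P? L) ≤ length (filter Q? L)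
length-filter-≤-injection P? Q? {L} L-unique F F-into F-inj = begin
  length (filter P? L)         ≡⟨ length-map F (filter P? L) ⟨
  length (map F (filter P? L)) ≤⟨ Unique-⊆⇒length≤ image-unique image⊆ ⟩
  length (filter Q? L)         ∎
  where
  open ≤-Reasoning
  image-unique : Unique (map F (filter P? L))
  image-unique = map-unique F (Unique.filter⁺ P? L-unique) λ x∈ y∈ →
    let x∈L , Px = ∈-filter⁻ P? x∈ ; y∈L , Py = ∈-filter⁻ P? y∈ in F-inj x∈L y∈L Px Py
  image⊆ : ∀ {z} → z ∈ map F (filter P? L) → z ∈ filter Q? L
  image⊆ z∈ with x , x∈ , refl ← ∈-map⁻ F z∈ with x∈L , Px ← ∈-filter⁻ P? x∈ =
    ∈-filter⁺ Q? (proj₁ (F-into x∈L Px)) (proj₂ (F-into x∈L Px))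

concatMap-unique : ∀ {A B : Set} {g : A → List B} (tag : B → A) {ks} → Unique ks →
  (∀ k → Unique (g k)) → (∀ {k x} → x ∈ g k → tag x ≡ k) → Unique (concatMap g ks)
concatMap-unique tag {[]} _ _ _ = []
concatMap-unique {g = g} tag {k ∷ ks} (k∉ks ∷ ks-unique) g-unique tagged =
  Unique.++⁺ (g-unique k) (concatMap-unique tag ks-unique g-unique tagged) disjoint
  where
  disjoint : ∀ {x} → ¬ (x ∈ g k × x ∈ concatMap g ks)
  disjoint (x∈ , x∈′) with k′ , k′∈ , x∈″ ← find (∈-concatMap⁻ g {xs = ks} x∈′) =
    All.lookup k∉ks k′∈ (trans (sym (tagged x∈)) (tagged x∈″))

withLargestPart : ℕ → ℕ → ℕ → List (List ℕ)
withLargestPart f n p with p ≤? suc n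
... | yes _ = map (p ∷_) (partitionsBounded f p (suc n ∸ p))
... | no _ = []

-- The local function `go` of partitionsBounded cannot be named; this recovers it by
-- unification with the unfolded definition.
private
  concatMapBody : ∀ {g : ℕ → List (List ℕ)} ks xss → xss ≡ concatMap g ks → ℕ → List (List ℕ)
  concatMapBody {g} _ _ _ = g

partitionsBounded-suc : ∀ f m n →
  partitionsBounded (suc f) m (suc n) ≡ concatMap (λ k → withLargestPart f n (suc k)) (upTo m)
partitionsBounded-suc f m n = concatMap-cong go≗ (upTo m)
  where
  go≗ : ∀ k → concatMapBody (upTo m) (partitionsBounded (suc f) m (suc n)) refl k ≡ withLargestPart f n (suc k)
  go≗ k with suc k ≤? suc n
  ... | yes _ = refl
  ... | no _ = refl

∈-withLargestPart⁻ : ∀ f n p {xs} → xs ∈ withLargestPart f n p →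
  p ≤ suc n × ∃[ ys ] xs ≡ p ∷ ys × ys ∈ partitionsBounded f p (suc n ∸ p)
∈-withLargestPart⁻ f n p xs∈ with p ≤? suc n
∈-withLargestPart⁻ f n p () | no _
... | yes p≤ with ys , ys∈ , refl ← ∈-map⁻ (p ∷_) xs∈ = p≤ , ys , refl , ys∈

∈-withLargestPart⁺ : ∀ f n p {ys} → p ≤ suc n → ys ∈ partitionsBounded f p (suc n ∸ p) →
  p ∷ ys ∈ withLargestPart f n p
∈-withLargestPart⁺ f n p p≤ ys∈ with p ≤? suc n
... | yes _ = ∈-map⁺ (p ∷_) ys∈
... | no p≰ = ⊥-elim (p≰ p≤)

∈-partitionsBounded⁻ : ∀ f m n {xs} → xs ∈ partitionsBounded f m n →
  Descending xs × All (1 ≤_) xs × All (_≤ m) xs × sum xs ≡ n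
∈-partitionsBounded⁻ f m zero (here refl) = [] , [] , [] , refl
∈-partitionsBounded⁻ (suc f) m (suc n) xs∈
  with k , k∈ , xs∈′ ← find (∈-concatMap⁻ _ {xs = upTo m} (subst (_ ∈_) (partitionsBounded-suc f m n) xs∈))
  with k<m ← ∈-upTo⁻ k∈
  with k≤n , ys , refl , ys∈ ← ∈-withLargestPart⁻ f n (suc k) xs∈′
  with desc , pos , bnd , sum≡ ← ∈-partitionsBounded⁻ f (suc k) (suc n ∸ suc k) ys∈
  = All≤head⇒Descending bnd desc
  , s≤s z≤n ∷ pos
  , k<m ∷ All.map (λ y≤ → ≤-trans y≤ k<m) bnd
  , trans (cong (suc k +_) sum≡) (m+[n∸m]≡n k≤n)

∈-partitionsBounded⁺ : ∀ f m {xs} → Descending xs → All (1 ≤_) xs → All (_≤ m) xs →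
  sum xs ≤ f → xs ∈ partitionsBounded f m (sum xs)
∈-partitionsBounded⁺ f m {[]} _ _ _ _ = here refl
∈-partitionsBounded⁺ (suc f) m {suc k ∷ ys} desc (_ ∷ pos) (k<m ∷ _) (s≤s sum≤f) =
  subst (_ ∈_) (sym (partitionsBounded-suc f m (k + sum ys)))
    (∈-concatMap⁺ _ (lose (∈-upTo⁺ k<m)
      (∈-withLargestPart⁺ f (k + sum ys) (suc k) (s≤s (m≤m+n k (sum ys)))
        (subst (λ s → ys ∈ partitionsBounded f (suc k) s) (sym (m+n∸m≡n k (sum ys)))
          (∈-partitionsBounded⁺ f (suc k) (Linked.tail desc) pos (Descending⇒All≤head desc)
            (≤-trans (m≤n+m (sum ys) k) sum≤f))))))

partitionsBounded-unique : ∀ f m n → Unique (partitionsBounded f m n)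
withLargestPart-unique : ∀ f n p → Unique (withLargestPart f n p)

partitionsBounded-unique f m zero = [] ∷ []
partitionsBounded-unique zero m (suc n) = []
partitionsBounded-unique (suc f) m (suc n) =
  subst Unique (sym (partitionsBounded-suc f m n))
    (concatMap-unique predHead (Unique.upTo⁺ m) (λ k → withLargestPart-unique f n (suc k)) tagged)
  where
  predHead : List ℕ → ℕ
  predHead [] = 0
  predHead (p ∷ _) = pred p
  tagged : ∀ {k xs} → xs ∈ withLargestPart f n (suc k) → predHead xs ≡ k
  tagged {k} xs∈ with _ , _ , refl , _ ← ∈-withLargestPart⁻ f n (suc k) xs∈ = refl

withLargestPart-unique f n p with p ≤? suc n
... | yes _ = Unique.map⁺ (λ eq → proj₂ (∷-injective eq)) (partitionsBounded-unique f p (suc n ∸ p))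
... | no _ = []

∈-partitions⁻ : ∀ n {xs} → xs ∈ partitions n → Descending xs × sum xs ≡ n
∈-partitions⁻ n xs∈ with desc , _ , _ , sum≡ ← ∈-partitionsBounded⁻ n n n xs∈ = desc , sum≡

∈-partitions⁺ : ∀ {xs} → Descending xs → All (1 ≤_) xs → xs ∈ partitions (sum xs)
∈-partitions⁺ {xs} desc pos = ∈-partitionsBounded⁺ (sum xs) (sum xs) desc pos (∈⇒≤sum xs) ≤-refl

-- The part j · 2^i is carried as the pair (j , i), so that its odd part j survives merging.
value : ℕ × ℕ → ℕ
value (j , i) = j * 2 ^ i

value-suc : ∀ j i → value (j , suc i) ≡ value (j , i) + value (j , i)
value-suc j i = trans (*-distribˡ-+ j (2 ^ i) (2 ^ i + 0)) (cong (j * 2 ^ i +_) (cong (j *_) (+-identityʳ (2 ^ i))))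

-- Insertion into a list ascending by value; two equal parts merge into one of twice the size,
-- which is then inserted further on, like a carry in binary addition.
insertCarry : ℕ × ℕ → List (ℕ × ℕ) → List (ℕ × ℕ)
insertCarry p [] = p ∷ []
insertCarry (j , i) (q ∷ qs) with <-cmp (value (j , i)) (value q)
... | tri< _ _ _ = (j , i) ∷ q ∷ qs
... | tri≈ _ _ _ = insertCarry (j , suc i) qs
... | tri> _ _ _ = q ∷ insertCarry (j , i) qs

merge : List ℕ → List (ℕ × ℕ)
merge = foldr (λ a → insertCarry (a , 0)) []

glaisher : List ℕ → List ℕ
glaisher xs = reverse (map value (merge xs))

sum-insertCarry : ∀ p qs → sum (map value (insertCarry p qs)) ≡ value p + sum (map value qs)
sum-insertCarry p [] = refl
sum-insertCarry (j , i) (q ∷ qs) with <-cmp (value (j , i)) (value q)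
... | tri< _ _ _ = refl
... | tri≈ _ p≡q _ = begin
  sum (map value (insertCarry (j , suc i) qs)) ≡⟨ sum-insertCarry (j , suc i) qs ⟩
  value (j , suc i) + rest                     ≡⟨ cong (_+ rest) (value-suc j i) ⟩
  (value (j , i) + value (j , i)) + rest       ≡⟨ +-assoc (value (j , i)) _ rest ⟩
  value (j , i) + (value (j , i) + rest)       ≡⟨ cong (λ v → value (j , i) + (v + rest)) p≡q ⟩
  value (j , i) + (value q + rest)             ∎
  where open ≡-Reasoning ; rest = sum (map value qs)
... | tri> _ _ _ = trans (cong (value q +_) (sum-insertCarry (j , i) qs)) (x∙yz≈y∙xz (value q) (value (j , i)) _)

sum-merge : ∀ xs → sum (map value (merge xs)) ≡ sum xs
sum-merge [] = refl
sum-merge (a ∷ xs) = trans (sum-insertCarry (a , 0) (merge xs)) (cong₂ _+_ (*-identityʳ a) (sum-merge xs))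

insertCarry-ascending : ∀ {b} p qs → Linked _<_ (b ∷ map value qs) → b < value p →
  Linked _<_ (b ∷ map value (insertCarry p qs))
insertCarry-ascending p [] _ b<p = b<p ∷ [-]
insertCarry-ascending (j , i) (q ∷ qs) asc@(b<q ∷ q-asc) b<p with <-cmp (value (j , i)) (value q)
... | tri< p<q _ _ = b<p ∷ p<q ∷ q-asc
... | tri≈ _ _ _ = insertCarry-ascending (j , suc i) qs (Linked-skip <-trans asc)
      (<-≤-trans b<p (≤-trans (m≤m+n _ _) (≤-reflexive (sym (value-suc j i)))))
... | tri> _ _ q<p = b<q ∷ insertCarry-ascending (j , i) qs q-asc q<p

merge-ascending : ∀ {b} xs → All (b <_) xs → Linked _<_ (b ∷ map value (merge xs))
merge-ascending [] [] = [-]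
merge-ascending (a ∷ xs) (b<a ∷ b<xs) =
  insertCarry-ascending (a , 0) (merge xs) (merge-ascending xs b<xs) (subst (_ <_) (sym (*-identityʳ a)) b<a)

glaisher-distinct : ∀ {b} xs → All (b <_) xs → DistinctParts (glaisher xs) × All (b <_) (glaisher xs)
glaisher-distinct xs b<xs with b<V ∷ _ ← Linked⇒AllPairs <-trans (merge-ascending xs b<xs) =
  Linked-reverse⁺ (Linked.tail (merge-ascending xs b<xs)) ,
  All-resp-↭ (↭-sym (↭-reverse (map value (merge xs)))) b<V

sum-glaisher : ∀ xs → sum (glaisher xs) ≡ sum xs
sum-glaisher xs = trans (sum-↭ (↭-reverse (map value (merge xs)))) (sum-merge xs)

m*2^0≡n*2^[1+o]⇒2∣m : ∀ {m} n o → m * 2 ^ 0 ≡ n * 2 ^ suc o → 2 ∣ m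
m*2^0≡n*2^[1+o]⇒2∣m {m} n o eq = subst (2 ∣_) (trans (sym eq) (*-identityʳ m)) (∣n⇒∣m*n n (m∣m*n (2 ^ o)))

odd*2^-injective : ∀ {j k} a b → Odd j → Odd k → j * 2 ^ a ≡ k * 2 ^ b → j ≡ k × a ≡ b
odd*2^-injective {j} {k} zero zero _ _ eq = trans (sym (*-identityʳ j)) (trans eq (*-identityʳ k)) , refl
odd*2^-injective {k = k} zero (suc b) odd-j _ eq = ⊥-elim (odd-j (m*2^0≡n*2^[1+o]⇒2∣m k b eq))
odd*2^-injective {j} (suc a) zero _ odd-k eq = ⊥-elim (odd-k (m*2^0≡n*2^[1+o]⇒2∣m j a (sym eq)))
odd*2^-injective {j} {k} (suc a) (suc b) odd-j odd-k eq
  with refl , refl ← odd*2^-injective a b odd-j odd-k (*-cancelˡ-≡ _ _ 2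
    (trans (sym (*.x∙yz≈y∙xz j 2 (2 ^ a))) (trans eq (*.x∙yz≈y∙xz k 2 (2 ^ b))))) = refl , refl

OddParts : List (ℕ × ℕ) → Set
OddParts = All (Odd ∘ proj₁)

insertCarry-odd : ∀ p qs → Odd (proj₁ p) → OddParts qs → OddParts (insertCarry p qs)
insertCarry-odd p [] odd-p _ = odd-p ∷ []
insertCarry-odd (j , i) (q ∷ qs) odd-p (odd-q ∷ odd-qs) with <-cmp (value (j , i)) (value q)
... | tri< _ _ _ = odd-p ∷ odd-q ∷ odd-qs
... | tri≈ _ _ _ = insertCarry-odd (j , suc i) qs odd-p odd-qs
... | tri> _ _ _ = odd-q ∷ insertCarry-odd (j , i) qs odd-p odd-qs

merge-odd : ∀ xs → All Odd xs → OddParts (merge xs)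
merge-odd [] [] = []
merge-odd (a ∷ xs) (odd-a ∷ odd-xs) = insertCarry-odd (a , 0) (merge xs) odd-a (merge-odd xs odd-xs)

map-value-injective : ∀ ps qs → OddParts ps → OddParts qs → map value ps ≡ map value qs → ps ≡ qs
map-value-injective [] [] _ _ _ = refl
map-value-injective ((j , a) ∷ ps) ((k , b) ∷ qs) (odd-j ∷ odd-ps) (odd-k ∷ odd-qs) eq
  with refl , refl ← odd*2^-injective a b odd-j odd-k (proj₁ (∷-injective eq)) =
  cong ((j , a) ∷_) (map-value-injective ps qs odd-ps odd-qs (proj₂ (∷-injective eq)))

ifYes : ∀ {P : Set} → Dec P → ℕ → ℕ
ifYes (yes _) k = k
ifYes (no _) _ = 0

multiplicity : ℕ → List ℕ → ℕ
multiplicity j [] = 0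
multiplicity j (a ∷ xs) = ifYes (a ≟ j) 1 + multiplicity j xs

-- A pair (j , i) stands for 2^i parts equal to j.
mergedMultiplicity : ℕ → List (ℕ × ℕ) → ℕ
mergedMultiplicity j [] = 0
mergedMultiplicity j ((a , i) ∷ ps) = ifYes (a ≟ j) (2 ^ i) + mergedMultiplicity j ps

ifYes-double : ∀ {P : Set} (d : Dec P) i → ifYes d (2 ^ suc i) ≡ ifYes d (2 ^ i) + ifYes d (2 ^ i)
ifYes-double (yes _) i = cong (2 ^ i +_) (+-identityʳ (2 ^ i))
ifYes-double (no _) i = refl

mergedMultiplicity-insertCarry : ∀ j a i qs → Odd a → OddParts qs →
  mergedMultiplicity j (insertCarry (a , i) qs) ≡ ifYes (a ≟ j) (2 ^ i) + mergedMultiplicity j qs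
mergedMultiplicity-insertCarry j a i [] _ _ = refl
mergedMultiplicity-insertCarry j a i ((b , i′) ∷ qs) odd-a (odd-b ∷ odd-qs)
  with <-cmp (value (a , i)) (value (b , i′))
... | tri< _ _ _ = refl
... | tri≈ _ eq _ with refl , refl ← odd*2^-injective i i′ odd-a odd-b eq = begin
  mergedMultiplicity j (insertCarry (a , suc i) qs)     ≡⟨ mergedMultiplicity-insertCarry j a (suc i) qs odd-a odd-qs ⟩
  ifYes (a ≟ j) (2 ^ suc i) + rest                      ≡⟨ cong (_+ rest) (ifYes-double (a ≟ j) i) ⟩
  (ifYes (a ≟ j) (2 ^ i) + ifYes (a ≟ j) (2 ^ i)) + rest ≡⟨ +-assoc (ifYes (a ≟ j) (2 ^ i)) _ rest ⟩
  ifYes (a ≟ j) (2 ^ i) + (ifYes (a ≟ j) (2 ^ i) + rest) ∎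
  where open ≡-Reasoning ; rest = mergedMultiplicity j qs
... | tri> _ _ _ = trans (cong (ifYes (b ≟ j) (2 ^ i′) +_) (mergedMultiplicity-insertCarry j a i qs odd-a odd-qs))
                         (x∙yz≈y∙xz (ifYes (b ≟ j) (2 ^ i′)) (ifYes (a ≟ j) (2 ^ i)) _)

mergedMultiplicity-merge : ∀ j xs → All Odd xs → mergedMultiplicity j (merge xs) ≡ multiplicity j xs
mergedMultiplicity-merge j [] _ = refl
mergedMultiplicity-merge j (a ∷ xs) (odd-a ∷ odd-xs) =
  trans (mergedMultiplicity-insertCarry j a 0 (merge xs) odd-a (merge-odd xs odd-xs))
        (cong (ifYes (a ≟ j) 1 +_) (mergedMultiplicity-merge j xs odd-xs))

multiplicity-head : ∀ y ys → multiplicity y (y ∷ ys) ≡ suc (multiplicity y ys)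
multiplicity-head y ys with y ≟ y
... | yes _ = refl
... | no y≢y = ⊥-elim (y≢y refl)

All<⇒multiplicity≡0 : ∀ y xs → All (_< y) xs → multiplicity y xs ≡ 0
All<⇒multiplicity≡0 y [] [] = refl
All<⇒multiplicity≡0 y (x ∷ xs) (x<y ∷ xs<y) with x ≟ y
... | yes refl = ⊥-elim (<-irrefl refl x<y)
... | no _ = All<⇒multiplicity≡0 y xs xs<y

multiplicity-below : ∀ {y} xs ys → All (_< y) xs → multiplicity y xs ≢ multiplicity y (y ∷ ys)
multiplicity-below {y} xs ys xs<y eq
  with () ← trans (sym (All<⇒multiplicity≡0 y xs xs<y)) (trans eq (multiplicity-head y ys))

Descending-below : ∀ {x y xs} → Descending (x ∷ xs) → x < y → All (_< y) (x ∷ xs)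
Descending-below desc x<y = x<y ∷ All.map (λ z≤x → ≤-<-trans z≤x x<y) (Descending⇒All≤head desc)

Descending-multiplicity-injective : ∀ xs ys → Descending xs → Descending ys →
  (∀ j → multiplicity j xs ≡ multiplicity j ys) → xs ≡ ys
Descending-multiplicity-injective [] [] _ _ _ = refl
Descending-multiplicity-injective [] (y ∷ ys) _ _ eq = ⊥-elim (multiplicity-below [] ys [] (eq y))
Descending-multiplicity-injective (x ∷ xs) [] _ _ eq = ⊥-elim (multiplicity-below [] xs [] (sym (eq x)))
Descending-multiplicity-injective (x ∷ xs) (y ∷ ys) dx dy eq with <-cmp x y
... | tri< x<y _ _ = ⊥-elim (multiplicity-below (x ∷ xs) ys (Descending-below dx x<y) (eq y))
... | tri> _ _ y<x = ⊥-elim (multiplicity-below (y ∷ ys) xs (Descending-below dy y<x) (sym (eq x)))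
... | tri≈ _ refl _ = cong (x ∷_) (Descending-multiplicity-injective xs ys (Linked.tail dx) (Linked.tail dy)
      (λ j → +-cancelˡ-≡ (ifYes (x ≟ j) 1) _ _ (eq j)))

glaisher-injective : ∀ xs ys → Descending xs → Descending ys → All Odd xs → All Odd ys →
  glaisher xs ≡ glaisher ys → xs ≡ ys
glaisher-injective xs ys dx dy odd-xs odd-ys eq = Descending-multiplicity-injective xs ys dx dy λ j → begin
  multiplicity j xs               ≡⟨ mergedMultiplicity-merge j xs odd-xs ⟨
  mergedMultiplicity j (merge xs) ≡⟨ cong (mergedMultiplicity j) merge≡ ⟩
  mergedMultiplicity j (merge ys) ≡⟨ mergedMultiplicity-merge j ys odd-ys ⟩
  multiplicity j ys               ∎
  where
  open ≡-Reasoning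
  merge≡ : merge xs ≡ merge ys
  merge≡ = map-value-injective (merge xs) (merge ys) (merge-odd xs odd-xs) (merge-odd ys odd-ys)
             (reverse-injective eq)

proposition4p1 : (n : ℕ) → 1 ≤ n → Q1-3m n ≤ q1-3 n
proposition4p1 n _ =
  length-filter-≤-injection (λ xs → all? odd? xs ×-dec all? (3 ≤?_) xs)
    (λ xs → distinctParts? xs ×-dec all? (3 ≤?_) xs) (partitionsBounded-unique n n n) glaisher into injective
  where
  into : ∀ {xs} → xs ∈ partitions n → All Odd xs × All (3 ≤_) xs →
    glaisher xs ∈ partitions n × DistinctParts (glaisher xs) × All (3 ≤_) (glaisher xs)
  into {xs} xs∈ (_ , 3≤xs)
    with _ , sum≡n ← ∈-partitions⁻ n xs∈
    with distinct , 3≤ ← glaisher-distinct xs 3≤xs =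
    subst (λ m → glaisher xs ∈ partitions m) (trans (sum-glaisher xs) sum≡n)
      (∈-partitions⁺ (Linked.map <⇒≤ distinct) (All.map (≤-trans (s≤s z≤n)) 3≤)) ,
    distinct , 3≤
  injective : ∀ {xs ys} → xs ∈ partitions n → ys ∈ partitions n → All Odd xs × All (3 ≤_) xs →
    All Odd ys × All (3 ≤_) ys → glaisher xs ≡ glaisher ys → xs ≡ ys
  injective xs∈ ys∈ (odd-xs , _) (odd-ys , _) =
    glaisher-injective _ _ (proj₁ (∈-partitions⁻ n xs∈)) (proj₁ (∈-partitions⁻ n ys∈)) odd-xs odd-ys
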